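{- Let $\mathfrak{A}$ be an input $\tau$-structure, $T$ a semantic context whose atomic modules are SM-PP atomic transductions, and $h$ a Choice function. Then any Kripke structure rooted in $\mathfrak{A}$ with states in $\mathbf{U}$ and transitions given by the atomic transitions $[\![\varepsilon M(\underline{\mathbf{X}};\mathbf{Y})]\!]_{T,h}$ of the logic $\mathbb{L}$ is a Register Kripke structure: along each transition the only relations that change are unary relations whose new interpretation is a singleton set, and all other relations are preserved.
   Context: $\mathbf{U}$ is the set of all $\tau$-structures over $\mathrm{dom}(\mathfrak{A})$. Atomic module expressions $M(\underline{\mathbf{X}};\mathbf{Y})$ have input variables $\mathbf{X}$ and output variables $\mathbf{Y}$, mapped to $\tau$ by an instantiation $s$. An SM-PP atomic transduction is a set of rules $R(x)\leftarrowtail B_1,\dots,B_m$, each meaning that the output relation $R$ is a singleton set with $\forall x\,(R(x)\to\exists z_1\dots\exists z_m(B_1\wedge\dots\wedge B_m))$, where each $B_i$ is an atom over a relational variable that is unary or is interpreted by the (unchanging) input structure. The semantic context gives, for each $M$, a set $S(M)$ of structures satisfying its specification and $[\![M(\underline{\mathbf{X}};\mathbf{Y})]\!]=\{(\mathfrak{A},\mathfrak{B}):\exists\mathfrak{C}\in S(M),\ \mathfrak{C}|_{s(\mathbf{X})}=\mathfrak{A}|_{s(\mathbf{X})},\ \mathfrak{C}|_{s(\mathbf{Y})}=\mathfrak{B}|_{s(\mathbf{Y})},\ \mathfrak{A}|_{\tau\setminus s(\mathbf{Y})}=\mathfrak{B}|_{\tau\setminus s(\mathbf{Y})}\}$. A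 Choice function $h:\mathbf{U}^*\to\mathbf{U}^*$ maps each word $x$ to a one-letter extension $x\cdot c$; $b(h)=\{\mathbf{e},h(\mathbf{e}),h(h(\mathbf{e})),\dots\}$, and $[\![\varepsilon M(\underline{\mathbf{X}};\mathbf{Y})]\!]_{T,h}=\{(w(\mathit{last}),w'(\mathit{last}))\in[\![M(\underline{\mathbf{X}};\mathbf{Y})]\!]: w'=h(w),\ w,w'\in b(h)\}$, so exactly one successor is selected. A Register Kripke structure is a pointed Kripke structure rooted in $\mathfrak{A}$ with states in $\mathbf{U}$, transitions in $\mathbf{U}\times\mathbf{U}$, in which the only relations that change from state to state are unary singleton-set relations. $\mathbb{L}$ denotes the dynamic logic of algebraic terms built from such $\varepsilon$-atomic modules with SM-PP atomic transductions. -}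

module Defs where

open import Level using (Level; _⊔_) renaming (suc to lsuc)
open import Data.Nat using (ℕ; zero; suc)
open import Data.Fin using (Fin)
import Data.Fin as Fin
open import Data.Bool using (Bool; true; false)
open import Data.Vec using (Vec; []; _∷_; map)
open import Data.List using (List; []; _∷_)
open import Data.List.Relation.Unary.All using (All)
open import Data.List.Relation.Unary.Any using (Any)
open import Data.Maybe using (Maybe; just; nothing)
open import Data.Product using (Σ; ∃; _×_; _,_)
open import Data.Sum using (_⊎_)
open import Function.Bundles using (_⇔_)
open import Relation.Nullary using (¬_)
open import Relation.Binary.PropositionalEquality using (_≡_; subst) renaming (sym to ≡-sym)

-- Vocabulary τ.  `Static` marks the symbols interpreted by the
-- (unchanging) input structure.

record Vocab : Set₁ where
  field
    Sym    : Set
    ar     : Sym → ℕ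
    Static : Sym → Set
open Vocab public

-- τ-structures over a fixed domain D = dom(𝔄).  U = Struct τ D.

module _ (τ : Vocab) (D : Set) where

  Struct : Set
  Struct = (R : Sym τ) → Vec D (ar τ R) → Bool

  AgreeOn : (Sym τ → Set) → Struct → Struct → Set
  AgreeOn P 𝔄 𝔅 = ∀ R → P R → ∀ v → 𝔄 R v ≡ 𝔅 R v

  IsSingleton : Struct → Sym τ → Set
  IsSingleton 𝔄 R = Σ (Vec D (ar τ R)) λ a → ∀ v → (𝔄 R v ≡ true) ⇔ (v ≡ a)

-- SM-PP rules  R(x) ↢ B₁,…,Bₘ  over the instantiated symbols.
-- Variables of a rule with k existential variables: Fin (suc k),
-- where `zero` is the head variable x and the others are z₁…z_k.

module _ (τ : Vocab) where

  record Atom (k : ℕ) : Set where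
    constructor atom
    field
      rel  : Sym τ
      args : Vec (Fin (suc k)) (ar τ rel)
  open Atom public

  record Rule : Set where
    field
      head      : Sym τ
      headUnary : ar τ head ≡ 1
      nvars     : ℕ
      body      : List (Atom nvars)
  open Rule public

  -- an atomic module expression M(X;Y) (instantiation s already applied:
  -- In / Out are the characteristic functions of s(X) / s(Y) ⊆ τ)
  -- whose atomic transduction is a set of rules
  record AtomicModule : Set where
    field
      In    : Sym τ → Bool
      Out   : Sym τ → Bool
      rules : List Rule
  open AtomicModule public

  IsSMPP : AtomicModule → Set
  IsSMPP M =
    (∀ R → Out M R ≡ true → ar τ R ≡ 1) ×
    All (λ r → (Out M (head r) ≡ true) ×
               All (λ B → ar τ (rel B) ≡ 1 ⊎ Static τ (rel B)) (body r))
        (rules M)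

  record Context : Set₁ where
    field
      Name : Set
      mod  : Name → AtomicModule
  open Context public

extend : ∀ {D : Set} {n} → D → (Fin n → D) → Fin (suc n) → D
extend x z Fin.zero    = x
extend x z (Fin.suc i) = z i

module _ {τ : Vocab} {D : Set} where

  HoldsAtom : ∀ {k} → Struct τ D → (Fin (suc k) → D) → Atom τ k → Set
  HoldsAtom 𝔄 ρ B = 𝔄 (rel B) (map ρ (args B)) ≡ true

  SatRule : Struct τ D → Rule τ → Set
  SatRule 𝔄 r = ∀ (x : D) →
    𝔄 (head r) (subst (Vec D) (≡-sym (headUnary r)) (x ∷ [])) ≡ true →
    Σ (Fin (nvars r) → D) λ z → All (HoldsAtom 𝔄 (extend x z)) (body r)

  Spec : AtomicModule τ → Struct τ D → Set
  Spec M ℭ = (∀ R → Out M R ≡ true → IsSingleton τ D ℭ R) × All (SatRule ℭ) (rules M)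

  ⟦_⟧ : AtomicModule τ → Struct τ D → Struct τ D → Set
  ⟦ M ⟧ 𝔄 𝔅 = Σ (Struct τ D) λ ℭ → Spec M ℭ ×
      AgreeOn τ D (λ R → In M R ≡ true) ℭ 𝔄 ×
      AgreeOn τ D (λ R → Out M R ≡ true) ℭ 𝔅 ×
      AgreeOn τ D (λ R → Out M R ≡ false) 𝔄 𝔅

  -- words over U, represented newest letter first: the last letter
  -- w(last) of a word is the head of the list
  Word : Set
  Word = List (Struct τ D)

  lastL : Word → Maybe (Struct τ D)
  lastL []      = nothing
  lastL (c ∷ _) = just c

  record Choice : Set where
    field
      fn  : Word → Word
      ext : ∀ w → Σ (Struct τ D) λ c → fn w ≡ c ∷ w
  open Choice public

  iter : Choice → ℕ → Word
  iter h zero    = []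
  iter h (suc n) = fn h (iter h n)

  InB : Choice → Word → Set
  InB h w = Σ ℕ λ n → w ≡ iter h n

  ⟦ε_⟧ : AtomicModule τ → Choice → Struct τ D → Struct τ D → Set
  ⟦ε M ⟧ h 𝔄 𝔅 = ⟦ M ⟧ 𝔄 𝔅 × Σ Word λ w → Σ Word λ w' →
      w' ≡ fn h w × InB h w × InB h w' ×
      lastL w ≡ just 𝔄 × lastL w' ≡ just 𝔅

  record Kripke (𝔄 : Struct τ D) : Set₁ where
    field
      State     : Struct τ D → Set
      Trans     : Struct τ D → Struct τ D → Set
      rootState : State 𝔄
      transOK   : ∀ {𝔅 𝔅'} → Trans 𝔅 𝔅' → State 𝔅 × State 𝔅'
  open Kripke public

  AtomicTransitions : ∀ {𝔄} → Context τ → Choice → Kripke 𝔄 → Set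
  AtomicTransitions T h K = ∀ {𝔅 𝔅'} → Trans K 𝔅 𝔅' →
      Σ (Name T) λ m → ⟦ε mod T m ⟧ h 𝔅 𝔅'

  IsRegisterKripke : ∀ {𝔄} → Kripke 𝔄 → Set
  IsRegisterKripke K = ∀ {𝔅 𝔅'} → Trans K 𝔅 𝔅' → ∀ R →
      (∀ v → 𝔅 R v ≡ 𝔅' R v) ⊎ (ar τ R ≡ 1 × IsSingleton τ D 𝔅' R)

{-# OPTIONS --safe #-}
module Submission where

open import Defs
open import Data.Bool using (true; false)
open import Data.Product using (_×_; _,_)
open import Data.Sum using (_⊎_; inj₁; inj₂)
open import Function.Bundles using (_⇔_)
open import Relation.Binary.PropositionalEquality using (_≡_; subst)

-- The choice function only decides which successor is taken; every atomic
-- transition is in particular a transition of ⟦ M ⟧, where the module's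
-- specification forces each output relation to be a singleton and every
-- other relation to be copied unchanged.

module _ {τ : Vocab} {D : Set} where

  IsSingleton-cong : ∀ (𝔄 𝔅 : Struct τ D) R →
    (∀ v → 𝔄 R v ≡ 𝔅 R v) → IsSingleton τ D 𝔄 R → IsSingleton τ D 𝔅 R
  IsSingleton-cong 𝔄 𝔅 R 𝔄≗𝔅 (a , 𝔄R≡a) =
    a , λ v → subst (λ b → (b ≡ true) ⇔ (v ≡ a)) (𝔄≗𝔅 v) (𝔄R≡a v)

  ⟦⟧-register : ∀ {M 𝔅 𝔅'} → IsSMPP τ M → ⟦ M ⟧ 𝔅 𝔅' → ∀ R →
    (∀ v → 𝔅 R v ≡ 𝔅' R v) ⊎ (ar τ R ≡ 1 × IsSingleton τ D 𝔅' R)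
  ⟦⟧-register {M} {𝔅' = 𝔅'} (outUnary , _)
              (ℭ , (outSingleton , _) , _ , ℭ≗𝔅' , 𝔅≗𝔅') R
    with Out M R in isOut
  ... | false = inj₁ (𝔅≗𝔅' R isOut)
  ... | true  = inj₂ (outUnary R isOut ,
                      IsSingleton-cong ℭ 𝔅' R (ℭ≗𝔅' R isOut) (outSingleton R isOut))

lemma2 : (τ : Vocab) (D : Set) (𝔄 : Struct τ D) (T : Context τ)
    → (∀ m → IsSMPP τ (mod T m))
    → (h : Choice {τ} {D})
    → (K : Kripke 𝔄)
    → AtomicTransitions T h K
    → IsRegisterKripke K
lemma2 τ D 𝔄 T smpp h K atomic t with atomic t
... | m , (moduleStep , _) = ⟦⟧-register (smpp m) moduleStep
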